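{- The complete graph $K_n$ of order $n$ is well-edge-dominated if and only if $n\le 4$.
   Context: A set $F$ of edges of a graph is an edge dominating set if every edge not in $F$ shares an endpoint with some edge of $F$; it is minimal if no proper subset is an edge dominating set. A graph is well-edge-dominated if all its minimal edge dominating sets have the same cardinality. -}

module Defs where

open import Data.Nat using (ℕ; zero; suc)
open import Data.Bool using (Bool; true; false; not; _∧_; if_then_else_)
open import Data.Fin using (Fin; toℕ; _<_; _<?_)
open import Data.Fin.Properties using (_≟_)
open import Data.List using (List; []; _∷_; length; filter; concatMap; allFin)
open import Data.Product using (_×_; _,_; Σ; ∃)
open import Data.Sum using (_⊎_)
open import Relation.Binary.PropositionalEquality using (_≡_)
open import Relation.Nullary using (¬_; Dec; yes; no)
open import Relation.Nullary.Decidable using (⌊_⌋)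

record Graph (n : ℕ) : Set where
  field
    adj    : Fin n → Fin n → Bool
    adj-sym    : ∀ i j → adj i j ≡ adj j i
    adj-irrefl : ∀ i → adj i i ≡ false
open Graph public

-- An edge {i , j} of G is represented canonically by the ordered pair (i , j)
-- with i < j and adj i j ≡ true.
IsEdge : ∀ {n} → Graph n → Fin n → Fin n → Set
IsEdge G i j = (i < j) × (adj G i j ≡ true)

PairSet : ℕ → Set
PairSet n = Fin n → Fin n → Bool

EdgeSetOf : ∀ {n} → Graph n → PairSet n → Set
EdgeSetOf G F = ∀ i j → F i j ≡ true → IsEdge G i j

_⊆_ : ∀ {n} → PairSet n → PairSet n → Set
F ⊆ F′ = ∀ i j → F i j ≡ true → F′ i j ≡ true

_⊂_ : ∀ {n} → PairSet n → PairSet n → Set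
F′ ⊂ F = (F′ ⊆ F) × ∃ λ i → ∃ λ j → (F i j ≡ true) × (F′ i j ≡ false)

ShareEndpoint : ∀ {n} → Fin n → Fin n → Fin n → Fin n → Set
ShareEndpoint a b c d = (a ≡ c) ⊎ (a ≡ d) ⊎ (b ≡ c) ⊎ (b ≡ d)

IsEDS : ∀ {n} → Graph n → PairSet n → Set
IsEDS G F =
  EdgeSetOf G F ×
  (∀ a b → IsEdge G a b → F a b ≡ false →
     ∃ λ c → ∃ λ d → (F c d ≡ true) × ShareEndpoint a b c d)

IsMinimalEDS : ∀ {n} → Graph n → PairSet n → Set
IsMinimalEDS G F = IsEDS G F × (∀ F′ → F′ ⊂ F → ¬ IsEDS G F′)

-- Cardinality of a set of canonical pairs: the number of pairs (i , j) with
-- i < j belonging to F.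
allPairs : ∀ n → List (Fin n × Fin n)
allPairs n = concatMap (λ i → Data.List.map (λ j → (i , j)) (allFin n)) (allFin n)

card : ∀ {n} → PairSet n → ℕ
card {n} F = length (filter (λ p → Data.Bool._≟_ (⌊ Data.Product.proj₁ p <? Data.Product.proj₂ p ⌋ ∧ F (Data.Product.proj₁ p) (Data.Product.proj₂ p)) true) (allPairs n))

WellEdgeDominated : ∀ {n} → Graph n → Set
WellEdgeDominated G = ∀ F F′ → IsMinimalEDS G F → IsMinimalEDS G F′ → card F ≡ card F′

K : (n : ℕ) → Graph n
K n = record
  { adj = λ i j → not ⌊ i ≟ j ⌋
  ; adj-sym = λ i j → symlemma i j
  ; adj-irrefl = λ i → irr i
  }
  where
  open import Relation.Binary.PropositionalEquality using (refl; sym)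
  irr : (i : Fin n) → not ⌊ i ≟ i ⌋ ≡ false
  irr i with i ≟ i
  ... | yes _ = refl
  ... | no ¬p = Data.Empty.⊥-elim (¬p refl)
    where import Data.Empty
  symlemma : (i j : Fin n) → not ⌊ i ≟ j ⌋ ≡ not ⌊ j ≟ i ⌋
  symlemma i j with i ≟ j | j ≟ i
  ... | yes _ | yes _ = refl
  ... | no _ | no _ = refl
  ... | yes p | no q = Data.Empty.⊥-elim (q (sym p))
    where import Data.Empty
  ... | no p | yes q = Data.Empty.⊥-elim (p (sym q))
    where import Data.Empty

-- In K_n an edge set dominates exactly when it leaves at most one vertex
-- uncovered, and such a set is minimal as soon as every edge has an endpoint
-- that no other edge covers: dropping the edge then uncovers that endpoint
-- besides the uncovered vertex. For n ≥ 5 this makes both the star from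
-- vertex 0 to all vertices but 4 and the set obtained from it by trading the
-- edges 02 and 03 for the edge 23 minimal, and they differ in size by one.
-- For n ≤ 4 all minimal edge dominating sets have ⌊n/2⌋ edges, which is a
-- finite check over the edge sets of K_n.
module Submission where

open import Defs
open import Data.Nat using (ℕ; _≤_)
open import Function.Bundles using (_⇔_)

open import Data.Nat using (zero; suc; _+_; z≤n; s≤s; _≤?_)
import Data.Nat as ℕ
open import Data.Nat.Properties using (+-comm; +-suc; 1+n≢n; n<1+n; ≰⇒>; m≤n⇒∃[o]m+o≡n)
open import Data.Bool using (Bool; true; false; not; _∧_; _∨_)
import Data.Bool as B
open import Data.Bool.Properties using (∧-distribˡ-∨; ∧-conicalˡ; ∧-conicalʳ; ∧-zeroʳ; ∨-zeroʳ)
open import Data.Fin using (Fin; zero; suc; _<_; _<?_; #_)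
open import Data.Fin.Properties using (_≟_; all?; any?; <-cmp; <⇒≢)
open import Data.List using (List; []; _∷_; length; filter; map; concatMap; allFin; cartesianProduct; _++_)
open import Data.List.Properties using (filter-accept; filter-reject; filter-none)
open import Data.List.Membership.Propositional using (_∈_)
open import Data.List.Membership.Propositional.Properties using (∈-allFin; ∈-cartesianProduct⁺; ∈-filter⁺)
open import Data.List.Relation.Unary.All as All using (All)
open import Data.List.Relation.Unary.Any using (here; there)
open import Data.List.Relation.Unary.Unique.Propositional using (Unique; _∷_)
open import Data.List.Relation.Unary.Unique.Propositional.Properties using (cartesianProduct⁺; allFin⁺)
open import Data.Vec using (Vec; []; _∷_)
open import Data.Product using (_×_; _,_; ∃; ∃₂; proj₁)
open import Data.Sum using (_⊎_; inj₁; inj₂; [_,_]′)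
import Data.Sum as Sum
open import Function using (_∘_)
open import Function.Bundles using (mk⇔)
open import Relation.Binary using (tri<; tri≈; tri>)
open import Relation.Binary.PropositionalEquality
  using (_≡_; _≢_; refl; sym; trans; cong; cong₂; subst; module ≡-Reasoning)
open import Relation.Nullary using (¬_; Dec; yes; no; ¬?; contradiction)
open import Relation.Nullary.Decidable
  using (_×-dec_; _⊎-dec_; _→-dec_; map′; ⌊_⌋; True; toWitness; dec-true; dec-false; isYes≗does)
open import Relation.Unary using (Decidable)

private
  variable
    A : Set
    n k : ℕ
    F G : PairSet n

⌊⌋-true : (a? : Dec A) → A → ⌊ a? ⌋ ≡ true
⌊⌋-true a? a = trans (isYes≗does a?) (dec-true a? a)

⌊⌋-false : (a? : Dec A) → ¬ A → ⌊ a? ⌋ ≡ false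
⌊⌋-false a? ¬a = trans (isYes≗does a?) (dec-false a? ¬a)

⌊suc≟suc⌋ : (i j : Fin n) → ⌊ suc i ≟ suc j ⌋ ≡ ⌊ i ≟ j ⌋
⌊suc≟suc⌋ i j with i ≟ j
... | yes _ = refl
... | no  _ = refl

holds? : (P : A → Bool) → Decidable (λ x → P x ≡ true)
holds? P x = P x B.≟ true

count : (A → Bool) → List A → ℕ
count P xs = length (filter (holds? P) xs)

count-cong : {P Q : A → Bool} → (∀ x → P x ≡ Q x) → ∀ xs → count P xs ≡ count Q xs
count-cong P≗Q [] = refl
count-cong {P = P} {Q} P≗Q (x ∷ xs) with P x | Q x | P≗Q x
... | true  | true  | refl = cong suc (count-cong P≗Q xs)
... | false | false | refl = count-cong P≗Q xs

count-∨ : (P Q : A → Bool) → (∀ x → P x ≡ true → Q x ≡ false) →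
          ∀ xs → count (λ x → P x ∨ Q x) xs ≡ count P xs + count Q xs
count-∨ P Q disjoint [] = refl
count-∨ P Q disjoint (x ∷ xs) with P x in Px | Q x in Qx
... | true  | true  = contradiction (trans (sym (disjoint x Px)) Qx) λ ()
... | true  | false = cong suc (count-∨ P Q disjoint xs)
... | false | true  = trans (cong suc (count-∨ P Q disjoint xs)) (sym (+-suc _ _))
... | false | false = count-∨ P Q disjoint xs

count-unique : (P : A → Bool) {x : A} → (∀ y → P y ≡ true → y ≡ x) → P x ≡ true →
               ∀ {xs} → Unique xs → x ∈ xs → count P xs ≡ 1
count-unique P only-x Px (x∉xs ∷ _) (here refl) =
  trans (cong length (filter-accept (holds? P) Px))
        (cong (suc ∘ length) (filter-none (holds? P) (All.map (λ x≢y Py → x≢y (sym (only-x _ Py))) x∉xs)))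
count-unique P only-x Px {y ∷ _} (y∉xs ∷ unique) (there x∈xs) =
  trans (cong length (filter-reject (holds? P) (λ Py → All.lookup y∉xs x∈xs (only-x y Py))))
        (count-unique P only-x Px unique x∈xs)

_∪_ : PairSet n → PairSet n → PairSet n
(F ∪ G) i j = F i j ∨ G i j

⟨_,_⟩ : Fin n → Fin n → PairSet n
⟨ x , y ⟩ i j = ⌊ i ≟ x ⌋ ∧ ⌊ j ≟ y ⌋

_≗₂_ : PairSet n → PairSet n → Set
F ≗₂ G = ∀ i j → F i j ≡ G i j

∪-elim : (F G : PairSet n) → ∀ i j → (F ∪ G) i j ≡ true → F i j ≡ true ⊎ G i j ≡ true
∪-elim F G i j e with F i j
... | true  = inj₁ refl
... | false = inj₂ e

⊆-∪ˡ : (F G : PairSet n) → F ⊆ (F ∪ G)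
⊆-∪ˡ F G i j e = cong (_∨ G i j) e

⊆-∪ʳ : (F G : PairSet n) → G ⊆ (F ∪ G)
⊆-∪ʳ F G i j e = trans (cong (F i j ∨_) e) (∨-zeroʳ (F i j))

⟨⟩-elim : (x y i j : Fin n) → ⟨ x , y ⟩ i j ≡ true → i ≡ x × j ≡ y
⟨⟩-elim x y i j e with i ≟ x | j ≟ y
... | yes i≡x | yes j≡y = i≡x , j≡y

⟨⟩-self : (x y : Fin n) → ⟨ x , y ⟩ x y ≡ true
⟨⟩-self x y rewrite ⌊⌋-true (x ≟ x) refl | ⌊⌋-true (y ≟ y) refl = refl

adj-K : (a b : Fin n) → a ≢ b → adj (K n) a b ≡ true
adj-K a b a≢b = cong not (⌊⌋-false (a ≟ b) a≢b)

EdgeSetOf-∪ : EdgeSetOf (K n) F → EdgeSetOf (K n) G → EdgeSetOf (K n) (F ∪ G)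
EdgeSetOf-∪ {F = F} {G} edgesF edgesG i j e = [ edgesF i j , edgesG i j ]′ (∪-elim F G i j e)

EdgeSetOf-⟨⟩ : ∀ {x y : Fin n} → x < y → EdgeSetOf (K n) ⟨ x , y ⟩
EdgeSetOf-⟨⟩ {x = x} {y} x<y i j e with ⟨⟩-elim x y i j e
... | refl , refl = x<y , adj-K x y (<⇒≢ x<y)

Covered : PairSet n → Fin n → Set
Covered F v = ∃₂ λ c d → F c d ≡ true × (v ≡ c ⊎ v ≡ d)

Covered-mono : F ⊆ G → ∀ {v} → Covered F v → Covered G v
Covered-mono F⊆G (c , d , Fcd , v∈cd) = c , d , F⊆G c d Fcd , v∈cd

Covered-∪⁻ : (F G : PairSet n) → ∀ {v} → Covered (F ∪ G) v → Covered F v ⊎ Covered G v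
Covered-∪⁻ F G (c , d , e , v∈cd) =
  Sum.map (λ Fcd → c , d , Fcd , v∈cd) (λ Gcd → c , d , Gcd , v∈cd) (∪-elim F G c d e)

⟨⟩-covers-first : (x y : Fin n) → Covered ⟨ x , y ⟩ x
⟨⟩-covers-first x y = x , y , ⟨⟩-self x y , inj₁ refl

⟨⟩-covers-second : (x y : Fin n) → Covered ⟨ x , y ⟩ y
⟨⟩-covers-second x y = x , y , ⟨⟩-self x y , inj₂ refl

⟨⟩-covered⁻ : ∀ {x y v : Fin n} → Covered ⟨ x , y ⟩ v → v ≡ x ⊎ v ≡ y
⟨⟩-covered⁻ {x = x} {y} (c , d , e , v∈cd) with ⟨⟩-elim x y c d e
... | refl , refl = v∈cd

shared-endpoint-covered : ∀ {a b c d : Fin n} → F c d ≡ true → ShareEndpoint a b c d →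
                          Covered F a ⊎ Covered F b
shared-endpoint-covered {c = c} {d} Fcd (inj₁ a≡c)               = inj₁ (c , d , Fcd , inj₁ a≡c)
shared-endpoint-covered {c = c} {d} Fcd (inj₂ (inj₁ a≡d))        = inj₁ (c , d , Fcd , inj₂ a≡d)
shared-endpoint-covered {c = c} {d} Fcd (inj₂ (inj₂ (inj₁ b≡c))) = inj₂ (c , d , Fcd , inj₁ b≡c)
shared-endpoint-covered {c = c} {d} Fcd (inj₂ (inj₂ (inj₂ b≡d))) = inj₂ (c , d , Fcd , inj₂ b≡d)

eds-covers-edge : IsEDS (K n) F → ∀ {a b} → a < b → Covered F a ⊎ Covered F b
eds-covers-edge {F = F} (_ , dominated) {a} {b} a<b with F a b in Fab
... | true  = inj₁ (a , b , Fab , inj₁ refl)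
... | false with dominated a b (a<b , adj-K a b (<⇒≢ a<b)) Fab
...   | _ , _ , Fcd , shared = shared-endpoint-covered Fcd shared

eds-covers-one-of : IsEDS (K n) F → ∀ {a b} → a ≢ b → Covered F a ⊎ Covered F b
eds-covers-one-of eds {a} {b} a≢b with <-cmp a b
... | tri< a<b _ _ = eds-covers-edge eds a<b
... | tri≈ _ a≡b _ = contradiction a≡b a≢b
... | tri> _ _ b<a = Sum.swap (eds-covers-edge eds b<a)

eds-if-covers-all-but : ∀ {u} → EdgeSetOf (K n) F → (∀ v → v ≢ u → Covered F v) → IsEDS (K n) F
eds-if-covers-all-but {n = n} {F = F} {u} edges covers = edges , dominated
  where
  dominated : ∀ a b → IsEdge (K n) a b → F a b ≡ false →
              ∃₂ λ c d → F c d ≡ true × ShareEndpoint a b c d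
  dominated a b (a<b , _) _ with a ≟ u
  ... | no a≢u = let c , d , Fcd , a∈cd = covers a a≢u
                 in c , d , Fcd , [ inj₁ , inj₂ ∘ inj₁ ]′ a∈cd
  ... | yes refl = let c , d , Fcd , b∈cd = covers b (<⇒≢ a<b ∘ sym)
                   in c , d , Fcd , inj₂ (inj₂ b∈cd)

-- Minimality through private endpoints

PrivateEndpoint : PairSet n → Fin n → Fin n → Fin n → Set
PrivateEndpoint F i j p =
  (p ≡ i ⊎ p ≡ j) × (∀ c d → F c d ≡ true → (p ≡ c ⊎ p ≡ d) → c ≡ i × d ≡ j)

PrivateEndpoint-∪ˡ : (F G : PairSet n) → ∀ {i j p} →
                     PrivateEndpoint F i j p → ¬ Covered G p → PrivateEndpoint (F ∪ G) i j p
PrivateEndpoint-∪ˡ F G (p∈ij , only-ij) p-free = p∈ij , λ c d e p∈cd →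
  [ (λ Fcd → only-ij c d Fcd p∈cd) , (λ Gcd → contradiction (c , d , Gcd , p∈cd) p-free) ]′
  (∪-elim F G c d e)

PrivateEndpoint-∪ʳ : (F G : PairSet n) → ∀ {i j p} →
                     PrivateEndpoint G i j p → ¬ Covered F p → PrivateEndpoint (F ∪ G) i j p
PrivateEndpoint-∪ʳ F G (p∈ij , only-ij) p-free = p∈ij , λ c d e p∈cd →
  [ (λ Fcd → contradiction (c , d , Fcd , p∈cd) p-free) , (λ Gcd → only-ij c d Gcd p∈cd) ]′
  (∪-elim F G c d e)

⟨⟩-private : (x y : Fin n) → PrivateEndpoint ⟨ x , y ⟩ x y y
⟨⟩-private x y = inj₂ refl , λ c d e _ → ⟨⟩-elim x y c d e

minimal-if-private-endpoints :
  ∀ {u} → EdgeSetOf (K n) F → (∀ v → v ≢ u → Covered F v) → ¬ Covered F u →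
  (∀ i j → F i j ≡ true → ∃ (PrivateEndpoint F i j)) → IsMinimalEDS (K n) F
minimal-if-private-endpoints {n = n} {F = F} {u} edges covers u-free private-endpoints =
  eds-if-covers-all-but edges covers , no-smaller
  where
  no-smaller : ∀ F′ → F′ ⊂ F → ¬ IsEDS (K n) F′
  no-smaller F′ (F′⊆F , i , j , Fij , F′ij) eds′ with private-endpoints i j Fij
  ... | p , p∈ij , only-ij =
    [ p-free , u-free ∘ Covered-mono F′⊆F ]′ (eds-covers-one-of eds′ p≢u)
    where
    p≢u : p ≢ u
    p≢u refl = u-free (i , j , Fij , p∈ij)
    p-free : ¬ Covered F′ p
    p-free (c , d , F′cd , p∈cd) with only-ij c d (F′⊆F c d F′cd) p∈cd
    ... | refl , refl = contradiction (trans (sym F′cd) F′ij) λ ()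

star : (Fin k → Bool) → PairSet (suc k)
star S zero (suc j) = S j
star S _    _       = false

star-edge : (S : Fin k → Bool) (c d : Fin (suc k)) → star S c d ≡ true →
            c ≡ zero × ∃ λ j → d ≡ suc j × S j ≡ true
star-edge S zero (suc j) e = refl , j , refl , e

EdgeSetOf-star : (S : Fin k → Bool) → EdgeSetOf (K (suc k)) (star S)
EdgeSetOf-star S c d e with star-edge S c d e
... | refl , j , refl , _ = s≤s z≤n , adj-K zero (suc j) λ ()

star-covers-centre : (S : Fin k → Bool) {j : Fin k} → S j ≡ true → Covered (star S) zero
star-covers-centre S {j} Sj = zero , suc j , Sj , inj₁ refl

star-covers-leaf : (S : Fin k → Bool) {j : Fin k} → S j ≡ true → Covered (star S) (suc j)
star-covers-leaf S {j} Sj = zero , suc j , Sj , inj₂ refl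

star-covered⁻ : (S : Fin k → Bool) → ∀ {v} → Covered (star S) v →
                v ≡ zero ⊎ ∃ λ j → v ≡ suc j × S j ≡ true
star-covered⁻ S (c , d , e , v∈cd) with star-edge S c d e | v∈cd
... | refl , _ , _      , _  | inj₁ v≡0  = inj₁ v≡0
... | refl , j , refl , Sj | inj₂ v≡sj = inj₂ (j , v≡sj , Sj)

star-private : (S : Fin k → Bool) → ∀ {i j} → star S i j ≡ true → PrivateEndpoint (star S) i j j
star-private S {i} {j} e with star-edge S i j e
... | refl , j , refl , _ = inj₂ refl , only-ij
  where
  only-ij : ∀ c d → star S c d ≡ true → (suc j ≡ c ⊎ suc j ≡ d) → c ≡ zero × d ≡ suc j
  only-ij c d e′ sj∈cd with star-edge S c d e′ | sj∈cd
  ... | refl , _ , refl , _ | inj₂ refl = refl , refl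

star-minimal : (S : Fin k → Bool) → ∀ {t j₀} →
               S t ≡ false → (∀ j → j ≢ t → S j ≡ true) → j₀ ≢ t → IsMinimalEDS (K (suc k)) (star S)
star-minimal S {t} {j₀} St all-but-t j₀≢t =
  minimal-if-private-endpoints (EdgeSetOf-star S) covers suc-t-free (λ i j e → j , star-private S e)
  where
  covers : ∀ v → v ≢ suc t → Covered (star S) v
  covers zero    _     = star-covers-centre S (all-but-t j₀ j₀≢t)
  covers (suc j) sj≢st = star-covers-leaf S (all-but-t j (sj≢st ∘ cong suc))
  suc-t-free : ¬ Covered (star S) (suc t)
  suc-t-free covered with star-covered⁻ S covered
  ... | inj₂ (_ , refl , St′) = contradiction (trans (sym St) St′) λ ()

addLeaf : Fin k → (Fin k → Bool) → Fin k → Bool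
addLeaf s S j = S j ∨ ⌊ j ≟ s ⌋

star-addLeaf : (s : Fin k) (S : Fin k → Bool) → star (addLeaf s S) ≗₂ (star S ∪ ⟨ zero , suc s ⟩)
star-addLeaf s S zero    zero    = refl
star-addLeaf s S zero    (suc j) = cong (S j ∨_) (sym (⌊suc≟suc⌋ j s))
star-addLeaf s S (suc i) j       = refl

allPairs≡cartesianProduct : ∀ n → allPairs n ≡ cartesianProduct (allFin n) (allFin n)
allPairs≡cartesianProduct n = go (allFin n)
  where
  go : ∀ xs → concatMap (λ i → map (i ,_) (allFin n)) xs ≡ cartesianProduct xs (allFin n)
  go []       = refl
  go (x ∷ xs) = cong (map (x ,_) (allFin n) ++_) (go xs)

allPairs-unique : ∀ n → Unique (allPairs n)
allPairs-unique n =
  subst Unique (sym (allPairs≡cartesianProduct n)) (cartesianProduct⁺ (allFin⁺ n) (allFin⁺ n))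

∈-allPairs : ∀ (i j : Fin n) → (i , j) ∈ allPairs n
∈-allPairs {n} i j =
  subst ((i , j) ∈_) (sym (allPairs≡cartesianProduct n)) (∈-cartesianProduct⁺ (∈-allFin i) (∈-allFin j))

canonical : PairSet n → Fin n × Fin n → Bool
canonical F (i , j) = ⌊ i <? j ⌋ ∧ F i j

card-cong : F ≗₂ G → card F ≡ card G
card-cong F≗G = count-cong (λ (i , j) → cong (⌊ i <? j ⌋ ∧_) (F≗G i j)) (allPairs _)

card-⟨⟩ : ∀ {x y : Fin n} → x < y → card ⟨ x , y ⟩ ≡ 1
card-⟨⟩ {n = n} {x} {y} x<y =
  count-unique (canonical ⟨ x , y ⟩) only-xy
               (trans (cong (_∧ ⟨ x , y ⟩ x y) (⌊⌋-true (x <? y) x<y)) (⟨⟩-self x y))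
               (allPairs-unique n) (∈-allPairs x y)
  where
  only-xy : ∀ p → canonical ⟨ x , y ⟩ p ≡ true → p ≡ (x , y)
  only-xy (i , j) e =
    let i≡x , j≡y = ⟨⟩-elim x y i j (∧-conicalʳ ⌊ i <? j ⌋ _ e) in cong₂ _,_ i≡x j≡y

card-insert : (F : PairSet n) → ∀ {x y} → x < y → F x y ≡ false →
              card (F ∪ ⟨ x , y ⟩) ≡ suc (card F)
card-insert {n = n} F {x} {y} x<y Fxy = begin
  card (F ∪ ⟨ x , y ⟩)
    ≡⟨ count-cong (λ (i , j) → ∧-distribˡ-∨ ⌊ i <? j ⌋ (F i j) _) (allPairs n) ⟩
  count (λ p → canonical F p ∨ canonical ⟨ x , y ⟩ p) (allPairs n)
    ≡⟨ count-∨ (canonical F) (canonical ⟨ x , y ⟩) disjoint (allPairs n) ⟩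
  card F + card ⟨ x , y ⟩
    ≡⟨ cong (card F +_) (card-⟨⟩ x<y) ⟩
  card F + 1
    ≡⟨ +-comm (card F) 1 ⟩
  suc (card F)
    ∎
  where
  open ≡-Reasoning
  disjoint : ∀ p → canonical F p ≡ true → canonical ⟨ x , y ⟩ p ≡ false
  disjoint (i , j) e with ⌊ i <? j ⌋ | ⟨ x , y ⟩ i j in xy
  ... | false | _     = refl
  ... | true  | false = refl
  ... | true  | true with ⟨⟩-elim x y i j xy
  ...   | refl , refl = contradiction (trans (sym e) Fxy) λ ()

card-star-addLeaf : (s : Fin k) (S : Fin k → Bool) → S s ≡ false →
                    card (star (addLeaf s S)) ≡ suc (card (star S))
card-star-addLeaf s S Ss = trans (card-cong (star-addLeaf s S)) (card-insert (star S) (s≤s z≤n) Ss)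

-- K_n with n ≥ 5 is not well-edge-dominated

module _ (m : ℕ) where

  -- leaf j of a star is vertex suc j, so the leaves 1, 2, 3 are the vertices 2, 3, 4
  leaves : Fin (4 + m) → Bool
  leaves (suc zero)             = false
  leaves (suc (suc zero))       = false
  leaves (suc (suc (suc zero))) = false
  leaves _                      = true

  edge23 : PairSet (5 + m)
  edge23 = ⟨ # 2 , # 3 ⟩

  bigStar : PairSet (5 + m)
  bigStar = star (addLeaf (# 2) (addLeaf (# 1) leaves))

  starAndEdge : PairSet (5 + m)
  starAndEdge = star leaves ∪ edge23

  bigStar-minimal : IsMinimalEDS (K (5 + m)) bigStar
  bigStar-minimal = star-minimal _ {t = # 3} {j₀ = zero} refl all-but-3 λ ()
    where
    all-but-3 : ∀ j → j ≢ # 3 → addLeaf (# 2) (addLeaf (# 1) leaves) j ≡ true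
    all-but-3 zero                      _   = refl
    all-but-3 (suc zero)                _   = refl
    all-but-3 (suc (suc zero))          _   = refl
    all-but-3 (suc (suc (suc zero)))    j≢3 = contradiction refl j≢3
    all-but-3 (suc (suc (suc (suc _)))) _   = refl

  starAndEdge-minimal : IsMinimalEDS (K (5 + m)) starAndEdge
  starAndEdge-minimal =
    minimal-if-private-endpoints (EdgeSetOf-∪ (EdgeSetOf-star leaves) (EdgeSetOf-⟨⟩ (n<1+n 2)))
                                 covers four-free private-endpoints
    where
    by-star : ∀ {v} → Covered (star leaves) v → Covered starAndEdge v
    by-star = Covered-mono (⊆-∪ˡ (star leaves) edge23)
    by-edge : ∀ {v} → Covered edge23 v → Covered starAndEdge v
    by-edge = Covered-mono (⊆-∪ʳ (star leaves) edge23)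

    covers : ∀ v → v ≢ # 4 → Covered starAndEdge v
    covers zero                            _   = by-star (star-covers-centre leaves {zero} refl)
    covers (suc zero)                      _   = by-star (star-covers-leaf leaves {zero} refl)
    covers (suc (suc zero))                _   = by-edge (⟨⟩-covers-first (# 2) (# 3))
    covers (suc (suc (suc zero)))          _   = by-edge (⟨⟩-covers-second (# 2) (# 3))
    covers (suc (suc (suc (suc zero))))    v≢4 = contradiction refl v≢4
    covers (suc (suc (suc (suc (suc j))))) _   = by-star (star-covers-leaf leaves {suc (suc (suc (suc j)))} refl)

    four-free : ¬ Covered starAndEdge (# 4)
    four-free covered with Covered-∪⁻ (star leaves) edge23 covered
    ... | inj₁ covered-by-star with star-covered⁻ leaves covered-by-star
    ...   | inj₂ (_ , refl , ())
    four-free covered | inj₂ covered-by-edge with ⟨⟩-covered⁻ covered-by-edge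
    ...   | inj₁ ()
    ...   | inj₂ ()

    edge-misses-leaves : ∀ {j} → leaves j ≡ true → ¬ Covered edge23 (suc j)
    edge-misses-leaves Lj covered with ⟨⟩-covered⁻ covered | Lj
    ... | inj₁ refl | ()
    ... | inj₂ refl | ()

    star-misses-3 : ¬ Covered (star leaves) (# 3)
    star-misses-3 covered with star-covered⁻ leaves covered
    ... | inj₂ (_ , refl , ())

    private-endpoints : ∀ i j → starAndEdge i j ≡ true → ∃ (PrivateEndpoint starAndEdge i j)
    private-endpoints i j e with ∪-elim (star leaves) edge23 i j e
    ... | inj₂ in-edge with ⟨⟩-elim (# 2) (# 3) i j in-edge
    ...   | refl , refl =
      # 3 , PrivateEndpoint-∪ʳ (star leaves) edge23 (⟨⟩-private (# 2) (# 3)) star-misses-3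
    private-endpoints i j e | inj₁ in-star with star-edge leaves i j in-star
    ...   | refl , _ , refl , Lj =
      j , PrivateEndpoint-∪ˡ (star leaves) edge23 (star-private leaves in-star) (edge-misses-leaves Lj)

  card-bigStar : card bigStar ≡ suc (card starAndEdge)
  card-bigStar = begin
    card bigStar                             ≡⟨ card-star-addLeaf (# 2) (addLeaf (# 1) leaves) refl ⟩
    suc (card (star (addLeaf (# 1) leaves))) ≡⟨ cong suc (card-star-addLeaf (# 1) leaves refl) ⟩
    suc (suc (card (star leaves)))           ≡⟨ cong suc (sym (card-insert (star leaves) (n<1+n 2) refl)) ⟩
    suc (card starAndEdge)                   ∎
    where open ≡-Reasoning

  K5+-not-wed : ¬ WellEdgeDominated (K (5 + m))
  K5+-not-wed wed = 1+n≢n (trans (sym card-bigStar) (wed _ _ bigStar-minimal starAndEdge-minimal))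

-- K_n with n ≤ 4 is well-edge-dominated

share? : (a b c d : Fin n) → Dec (ShareEndpoint a b c d)
share? a b c d = (a ≟ c) ⊎-dec (a ≟ d) ⊎-dec (b ≟ c) ⊎-dec (b ≟ d)

isEDS? : (F : PairSet n) → Dec (IsEDS (K n) F)
isEDS? F =
  all? (λ i → all? (λ j → (F i j B.≟ true) →-dec ((i <? j) ×-dec (not _ B.≟ true))))
  ×-dec
  all? (λ a → all? (λ b → ((a <? b) ×-dec (not _ B.≟ true)) →-dec ((F a b B.≟ false) →-dec
    any? (λ c → any? (λ d → (F c d B.≟ true) ×-dec share? a b c d)))))

IsEDS-resp : F ≗₂ G → IsEDS (K n) F → IsEDS (K n) G
IsEDS-resp F≗G (edges , dominated) =
  (λ i j Gij → edges i j (trans (F≗G i j) Gij)) ,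
  λ a b ab Gab → let c , d , Fcd , shared = dominated a b ab (trans (F≗G a b) Gab)
                 in c , d , trans (sym (F≗G c d)) Fcd , shared

IsMinimalEDS-resp : F ≗₂ G → IsMinimalEDS (K n) F → IsMinimalEDS (K n) G
IsMinimalEDS-resp F≗G (eds , minimal) =
  IsEDS-resp F≗G eds ,
  λ G′ (G′⊆G , i , j , Gij , G′ij) →
    minimal G′ ((λ c d e → trans (F≗G c d) (G′⊆G c d e)) , i , j , trans (F≗G i j) Gij , G′ij)

_∖⟨_,_⟩ : PairSet n → Fin n → Fin n → PairSet n
(F ∖⟨ a , b ⟩) i j = F i j ∧ not (⟨ a , b ⟩ i j)

∖-⊂ : (F : PairSet n) (a b : Fin n) → F a b ≡ true → (F ∖⟨ a , b ⟩) ⊂ F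
∖-⊂ F a b Fab =
  (λ i j e → ∧-conicalˡ (F i j) _ e) ,
  a , b , Fab , trans (cong (λ x → F a b ∧ not x) (⟨⟩-self a b)) (∧-zeroʳ (F a b))

NonMinimalOrOfSize : ℕ → PairSet n → Set
NonMinimalOrOfSize {n} c F =
  ¬ IsEDS (K n) F ⊎ (∃₂ λ a b → F a b ≡ true × IsEDS (K n) (F ∖⟨ a , b ⟩)) ⊎ card F ≡ c

nonMinimalOrOfSize? : ∀ c (F : PairSet n) → Dec (NonMinimalOrOfSize c F)
nonMinimalOrOfSize? c F =
  ¬? (isEDS? F)
  ⊎-dec any? (λ a → any? (λ b → (F a b B.≟ true) ×-dec isEDS? (F ∖⟨ a , b ⟩)))
  ⊎-dec (card F ℕ.≟ c)

card-if-minimal : ∀ {c} (F : PairSet n) → NonMinimalOrOfSize c F → IsMinimalEDS (K n) F → card F ≡ c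
card-if-minimal F (inj₁ ¬eds)                         (eds , _) = contradiction eds ¬eds
card-if-minimal F (inj₂ (inj₁ (a , b , Fab , eds′))) (_ , min)  = contradiction eds′ (min _ (∖-⊂ F a b Fab))
card-if-minimal F (inj₂ (inj₂ size))                  _         = size

canonicalPairs : ∀ n → List (Fin n × Fin n)
canonicalPairs n = filter (λ (i , j) → i <? j) (allPairs n)

∈-canonicalPairs : ∀ {i j : Fin n} → i < j → (i , j) ∈ canonicalPairs n
∈-canonicalPairs {i = i} {j} = ∈-filter⁺ (λ (i , j) → i <? j) (∈-allPairs i j)

fromBits : (ps : List (Fin n × Fin n)) → Vec Bool (length ps) → PairSet n
fromBits []             []       i j = false
fromBits ((a , b) ∷ ps) (x ∷ xs) i j = (x ∧ ⟨ a , b ⟩ i j) ∨ fromBits ps xs i j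

toBits : PairSet n → (ps : List (Fin n × Fin n)) → Vec Bool (length ps)
toBits F []             = []
toBits F ((a , b) ∷ ps) = F a b ∷ toBits F ps

fromBits-toBits⁻ : (F : PairSet n) (ps : List (Fin n × Fin n)) → ∀ {i j} →
                   fromBits ps (toBits F ps) i j ≡ true → F i j ≡ true
fromBits-toBits⁻ F ((a , b) ∷ ps) {i} {j} e with F a b in Fab | ⟨ a , b ⟩ i j in ab
... | true  | true with ⟨⟩-elim a b i j ab
...   | refl , refl = Fab
fromBits-toBits⁻ F ((a , b) ∷ ps) e | true  | false = fromBits-toBits⁻ F ps e
fromBits-toBits⁻ F ((a , b) ∷ ps) e | false | _     = fromBits-toBits⁻ F ps e

fromBits-toBits⁺ : (F : PairSet n) {ps : List (Fin n × Fin n)} → ∀ {i j} → (i , j) ∈ ps →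
                   F i j ≡ true → fromBits ps (toBits F ps) i j ≡ true
fromBits-toBits⁺ F {(i , j) ∷ ps} (here refl) Fij =
  cong (_∨ fromBits ps (toBits F ps) i j) (cong₂ _∧_ Fij (⟨⟩-self i j))
fromBits-toBits⁺ F {(a , b) ∷ _} {i} {j} (there ij∈ps) Fij =
  trans (cong ((F a b ∧ ⟨ a , b ⟩ i j) ∨_) (fromBits-toBits⁺ F ij∈ps Fij)) (∨-zeroʳ _)

fromBits-toBits : (F : PairSet n) → EdgeSetOf (K n) F →
                  F ≗₂ fromBits (canonicalPairs n) (toBits F (canonicalPairs n))
fromBits-toBits {n} F edges i j with F i j in Fij
... | true = sym (fromBits-toBits⁺ F (∈-canonicalPairs (proj₁ (edges i j Fij))) Fij)
... | false with fromBits (canonicalPairs n) (toBits F (canonicalPairs n)) i j in bits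
...   | false = refl
...   | true  = contradiction (trans (sym (fromBits-toBits⁻ F (canonicalPairs n) bits)) Fij) λ ()

all-bits? : ∀ {k} {P : Vec Bool k → Set} → Decidable P → Dec (∀ bs → P bs)
all-bits? {zero}  P? = map′ (λ { p [] → p }) (λ h → h []) (P? [])
all-bits? {suc k} P? =
  map′ (λ { (f , t) (false ∷ bs) → f bs ; (f , t) (true ∷ bs) → t bs })
       (λ h → (λ bs → h (false ∷ bs)) , (λ bs → h (true ∷ bs)))
       (all-bits? (λ bs → P? (false ∷ bs)) ×-dec all-bits? (λ bs → P? (true ∷ bs)))

wed-by-enumeration :
  ∀ n c → True (all-bits? (λ bs → nonMinimalOrOfSize? c (fromBits (canonicalPairs n) bs))) →
  WellEdgeDominated (K n)
wed-by-enumeration n c checked F F′ minimal minimal′ = trans (size F minimal) (sym (size F′ minimal′))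
  where
  size : ∀ F → IsMinimalEDS (K n) F → card F ≡ c
  size F minimal =
    let F≗bits = fromBits-toBits F (proj₁ (proj₁ minimal))
    in trans (card-cong F≗bits)
             (card-if-minimal _ (toWitness checked _) (IsMinimalEDS-resp F≗bits minimal))

K≤4-wed : n ≤ 4 → WellEdgeDominated (K n)
K≤4-wed z≤n                         = wed-by-enumeration 0 0 _
K≤4-wed (s≤s z≤n)                   = wed-by-enumeration 1 0 _
K≤4-wed (s≤s (s≤s z≤n))             = wed-by-enumeration 2 1 _
K≤4-wed (s≤s (s≤s (s≤s z≤n)))       = wed-by-enumeration 3 1 _
K≤4-wed (s≤s (s≤s (s≤s (s≤s z≤n)))) = wed-by-enumeration 4 2 _

wed-K⇒≤4 : ∀ n → WellEdgeDominated (K n) → n ≤ 4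
wed-K⇒≤4 n wed with n ≤? 4
... | yes n≤4 = n≤4
... | no n≰4 with m≤n⇒∃[o]m+o≡n (≰⇒> n≰4)
...   | m , refl = contradiction wed (K5+-not-wed m)

lemma4 : (n : ℕ) → WellEdgeDominated (K n) ⇔ (n ≤ 4)
lemma4 n = mk⇔ (wed-K⇒≤4 n) K≤4-wed
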